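{- Let $k$ be a nonnegative integer and $S\in\mathsf{APS}^B_{2k+1}\setminus\mathsf{APS}^D_{2k+1}$, and set $P=S\cap\mathbb{N}$ and $N=S\cap-\mathbb{N}$. Then $P$ consists of exactly the $k-|N|$ smallest elements of $[2k+1]\setminus -N$. In particular, $N$ determines $P$, and hence $S$.
   Context: $\mathbb{N}=\{1,2,\dots\}$, $[n]=\{1,\dots,n\}$, $-X=\{ -x:x\in X\}$, $\pm[n]=[n]\cup-[n]$. $\mathfrak{S}_n^B$ is the group of bijections $w:\pm[n]\to\pm[n]$ with $w(-i)=-w(i)$, written in one-line notation $w(1)\cdots w(n)$; $\mathfrak{S}_n^D\subseteq\mathfrak{S}_n^B$ consists of those $w$ with $|\{i\in[n]:w(i)<0\}|$ even. A pinnacle of $w$ is a value $w(i)$ with $2\le i\le n-1$ and $w(i-1)<w(i)>w(i+1)$; the pinnacle set of $w$ is the set of its pinnacles. $\mathsf{APS}^B_n$ (resp. $\mathsf{APS}^D_n$) is the set of pinnacle sets of elements of $\mathfrak{S}_n^B$ (resp. $\mathfrak{S}_n^D$). -}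

module Defs where

open import Data.Nat as ℕ using (ℕ; suc; _∸_)
open import Data.Nat.Divisibility using (_∣_)
open import Data.Integer as ℤ using (ℤ; +_; -_; ∣_∣; _<_; 0ℤ)
open import Data.List using (List; []; _∷_; _++_; length; map; filter; upTo)
open import Data.List.Membership.Propositional using (_∈_)
open import Data.List.Relation.Binary.Permutation.Propositional using (_↭_)
open import Data.Product using (Σ; _×_; ∃; ∃-syntax)
open import Function.Bundles using (_⇔_)
open import Relation.Nullary using (¬_)
open import Relation.Unary using (∁)
import Data.List.Membership.DecPropositional as DecMem

open DecMem ℤ._≟_ using (_∈?_)

[_] : ℕ → List ℕ
[ n ] = map suc (upTo n)

-- A signed permutation of [n], in one-line notation w(1)⋯w(n) (a list of
-- integers of length n): the absolute values form a permutation of [n].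
-- This is exactly an element of 𝔖ⁿ_B (w(-i) = -w(i) determines the rest).
SignedPerm : ℕ → List ℤ → Set
SignedPerm n w = length w ≡ n × map ∣_∣ w ↭ [ n ]
  where open import Relation.Binary.PropositionalEquality using (_≡_)

negCount : List ℤ → ℕ
negCount w = length (filter (ℤ._<? 0ℤ) w)

TypeDPerm : ℕ → List ℤ → Set
TypeDPerm n w = SignedPerm n w × 2 ∣ negCount w

IsPinnacle : List ℤ → ℤ → Set
IsPinnacle w x = ∃[ xs ] ∃[ ys ] ∃[ a ] ∃[ c ]
  (w ≡ xs ++ a ∷ x ∷ c ∷ ys × a < x × c < x)
  where open import Relation.Binary.PropositionalEquality using (_≡_)

-- Finite sets of integers are represented by lists, read up to membership.
-- "S is the pinnacle set of w"
PinnacleSetOf : List ℤ → List ℤ → Set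
PinnacleSetOf w S = ∀ x → (x ∈ S) ⇔ IsPinnacle w x

APS-B : ℕ → List ℤ → Set
APS-B n S = ∃[ w ] (SignedPerm n w × PinnacleSetOf w S)

APS-D : ℕ → List ℤ → Set
APS-D n S = ∃[ w ] (TypeDPerm n w × PinnacleSetOf w S)

negPartSize : ℕ → List ℤ → ℕ
negPartSize n S = length (filter (λ j → - (+ j) ∈? S) [ n ])

InComplement : ℕ → List ℤ → ℕ → Set
InComplement n S j = j ∈ [ n ] × ¬ (- (+ j) ∈ S)

rankInComplement : ℕ → List ℤ → ℕ → ℕ
rankInComplement n S j =
  length (filter (λ i → ¬? (- (+ i) ∈? S)) (filter (ℕ._<? j) [ n ]))
  where open import Relation.Nullary.Decidable using (¬?)

module Submission where

-- If S ∈ APSᴮ ∖ APSᴰ and w is a signed permutation with pinnacle set S, then no entry of w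
-- can be negated without changing the pinnacle set: the two signed permutations would have
-- negCounts of different parity, so one of them would put S in APSᴰ. Applying this to w and
-- to rearrangements of w with the same pinnacle set forces w = v₀ p₁ v₁ ⋯ p_k v_k to
-- alternate, with all valleys vᵢ negative and every positive pinnacle below every |vᵢ|. So
-- [2k+1] is the disjoint union of P, -N and the |vᵢ|, where |P| + |N| = k and P lies below
-- all |vᵢ|: P consists of the k - |N| smallest elements of [2k+1] ∖ -N.

open import Defs
open import Data.Nat using (ℕ; _+_; _*_; _∸_; _<_)
open import Data.Integer using (ℤ; +_; -_)
open import Data.List using (List)
open import Data.List.Membership.Propositional using (_∈_)
open import Data.Product using (_×_)
open import Function.Bundles using (_⇔_)
open import Relation.Nullary using (¬_)

open import Data.Empty using (⊥; ⊥-elim)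
open import Data.Integer as ℤ using (∣_∣; 0ℤ) renaming (_<_ to _<ᶻ_; _≤_ to _≤ᶻ_)
import Data.Integer.Properties as ℤ
open import Data.List using ([]; _∷_; _++_; length; drop; filter; map)
open import Data.List.Properties using (++-assoc; map-++; length-++; length-map; filter-++; filter-none)
open import Data.List.Membership.DecPropositional ℤ._≟_ using (_∈?_)
open import Data.List.Membership.Propositional.Properties using (∈-++⁺ˡ; ∈-++⁺ʳ; ∈-++⁻; ∈-map⁺; ∈-map⁻)
open import Data.List.Relation.Binary.Permutation.Propositional
  using (_↭_; ↭-refl; ↭-reflexive; ↭-sym; ↭-trans; prep; swap; ↭⇒↭ₛ)
open import Data.List.Relation.Binary.Permutation.Propositional.Properties
  using (∈-resp-↭; ↭-length; filter-↭; map⁺) renaming (shift to ↭-shift; shifts to ↭-shifts)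
import Data.List.Relation.Binary.Permutation.Setoid.Properties as PermutationSetoid
import Data.List.Relation.Unary.All as All
import Data.List.Relation.Unary.AllPairs as AllPairs
open import Data.List.Relation.Unary.Any using (here; there)
open import Data.List.Relation.Unary.Unique.Propositional using (Unique)
import Data.List.Relation.Unary.Unique.Propositional.Properties as Unique
open import Data.Nat using (zero; suc; _≤_; z≤n; s≤s; _<?_)
open import Data.Nat.Divisibility using (_∣_; divides)
import Data.Nat.Properties as ℕ
open import Data.Product using (∃-syntax; _,_; proj₁; proj₂)
open import Data.Sum using (_⊎_; inj₁; inj₂; map₂)
open import Function using (_∘_)
open import Function.Bundles using (mk⇔; Equivalence)
open import Level using (0ℓ)
open import Relation.Binary.Definitions using (tri<; tri≈; tri>)
open import Relation.Binary.PropositionalEquality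
  using (_≡_; _≢_; refl; sym; trans; cong; cong₂; subst; subst₂; setoid; module ≡-Reasoning)
open import Relation.Nullary using (Dec; yes; no; ¬?)
open import Relation.Unary using (Pred; Decidable; _≐_)
open import Relation.Unary.Properties using (≐-refl; ≐-sym; ≐-trans; _∩?_)

data Pinnacle : List ℤ → Pred ℤ 0ℓ where
  at    : ∀ {a x c r} → a <ᶻ x → c <ᶻ x → Pinnacle (a ∷ x ∷ c ∷ r) x
  later : ∀ {a r x} → Pinnacle r x → Pinnacle (a ∷ r) x

IsPinnacle⇒Pinnacle : ∀ {w x} → IsPinnacle w x → Pinnacle w x
IsPinnacle⇒Pinnacle ([] , ys , a , c , refl , a<x , c<x) = at a<x c<x
IsPinnacle⇒Pinnacle (y ∷ xs , ys , a , c , refl , a<x , c<x) =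
  later (IsPinnacle⇒Pinnacle (xs , ys , a , c , refl , a<x , c<x))

Pinnacle⇒IsPinnacle : ∀ {w x} → Pinnacle w x → IsPinnacle w x
Pinnacle⇒IsPinnacle (at {c = c} {r} a<x c<x) = [] , r , _ , c , refl , a<x , c<x
Pinnacle⇒IsPinnacle {y ∷ _} (later p) with Pinnacle⇒IsPinnacle p
... | xs , ys , a , c , refl , a<x , c<x = y ∷ xs , ys , a , c , refl , a<x , c<x

Falls : List ℤ → Set
Falls (a ∷ b ∷ _) = b <ᶻ a
Falls _ = ⊥

Rises : List ℤ → Set
Rises (a ∷ b ∷ _) = a <ᶻ b
Rises _ = ⊥

data SameOpening : List ℤ → List ℤ → Set where
  []  : SameOpening [] []
  _∷_ : ∀ a {L M} → (Falls (a ∷ L) → Falls (a ∷ M)) × (Falls (a ∷ M) → Falls (a ∷ L)) →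
        SameOpening (a ∷ L) (a ∷ M)

-- Lists that can replace each other after any common prefix without changing the pinnacle set.
Interchangeable : List ℤ → List ℤ → Set
Interchangeable L M = SameOpening L M × Pinnacle L ≐ Pinnacle M

rises-then-falls : ∀ {a b L} → a <ᶻ b → Falls (b ∷ L) → Pinnacle (a ∷ b ∷ L) b
rises-then-falls {L = c ∷ L} a<b c<b = at a<b c<b

∷-interchangeable : ∀ y {L M} → Interchangeable L M → Interchangeable (y ∷ L) (y ∷ M)
∷-interchangeable y ([] , _) = (y ∷ ((λ ()) , (λ ()))) , ≐-refl
∷-interchangeable y ((a ∷ (falls , falls′)) , L≐M) =
  (y ∷ ((λ a<y → a<y) , (λ a<y → a<y))) , lift falls (proj₁ L≐M) , lift falls′ (proj₂ L≐M)
  where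
  lift : ∀ {L M} → (Falls (a ∷ L) → Falls (a ∷ M)) →
         (∀ {x} → Pinnacle (a ∷ L) x → Pinnacle (a ∷ M) x) →
         ∀ {x} → Pinnacle (y ∷ a ∷ L) x → Pinnacle (y ∷ a ∷ M) x
  lift falls _ (at y<a c<a) = rises-then-falls y<a (falls c<a)
  lift _ L⊆M (later p) = later (L⊆M p)

++-interchangeable : ∀ A {L M} → Interchangeable L M → Interchangeable (A ++ L) (A ++ M)
++-interchangeable [] L≈M = L≈M
++-interchangeable (y ∷ A) L≈M = ∷-interchangeable y (++-interchangeable A L≈M)

head-replace : ∀ {a a′ b r} →
               (a <ᶻ b → Falls (b ∷ r) → a′ <ᶻ b) → (a′ <ᶻ b → Falls (b ∷ r) → a <ᶻ b) →
               Pinnacle (a ∷ b ∷ r) ≐ Pinnacle (a′ ∷ b ∷ r)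
head-replace to from = replace to , replace from
  where
  replace : ∀ {a a′ b r} → (a <ᶻ b → Falls (b ∷ r) → a′ <ᶻ b) →
            ∀ {x} → Pinnacle (a ∷ b ∷ r) x → Pinnacle (a′ ∷ b ∷ r) x
  replace f (at a<b c<b) = at (f a<b c<b) c<b
  replace f (later p) = later p

head-irrelevant : ∀ {a a′ b r} → ¬ Falls (b ∷ r) → Pinnacle (a ∷ b ∷ r) ≐ Pinnacle (a′ ∷ b ∷ r)
head-irrelevant ¬falls = head-replace (λ _ falls → ⊥-elim (¬falls falls)) (λ _ falls → ⊥-elim (¬falls falls))

rises⇒¬falls : ∀ {R} → Rises R → ¬ Falls R
rises⇒¬falls {_ ∷ _ ∷ _} a<b b<a = ℤ.<-asym a<b b<a

prepend-before-rise : ∀ {c} R → Rises R → Pinnacle (c ∷ R) ≐ Pinnacle R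
prepend-before-rise (p ∷ q ∷ r) p<q = forget , later
  where
  forget : ∀ {x} → Pinnacle (_ ∷ p ∷ q ∷ r) x → Pinnacle (p ∷ q ∷ r) x
  forget (at _ q<p) = ⊥-elim (ℤ.<-asym p<q q<p)
  forget (later p) = p

Monotone : ℤ → ℤ → ℤ → Set
Monotone x y z = (x <ᶻ y × y <ᶻ z) ⊎ (z <ᶻ y × y <ᶻ x)

skip-monotone : ∀ {x y z B} → Monotone x y z → Interchangeable (x ∷ z ∷ B) (x ∷ y ∷ z ∷ B)
skip-monotone {x} {y} {z} (inj₁ (x<y , y<z)) =
  (x ∷ ((λ z<x → ⊥-elim (ℤ.<-asym z<x (ℤ.<-trans x<y y<z))) , (λ y<x → ⊥-elim (ℤ.<-asym y<x x<y)))) ,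
  insert , skip
  where
  insert : ∀ {v} → Pinnacle (x ∷ z ∷ _) v → Pinnacle (x ∷ y ∷ z ∷ _) v
  insert (at _ c<z) = later (at y<z c<z)
  insert (later p) = later (later p)
  skip : ∀ {v} → Pinnacle (x ∷ y ∷ z ∷ _) v → Pinnacle (x ∷ z ∷ _) v
  skip (at _ z<y) = ⊥-elim (ℤ.<-asym z<y y<z)
  skip (later (at _ c<z)) = at (ℤ.<-trans x<y y<z) c<z
  skip (later (later p)) = later p
skip-monotone {x} {y} {z} (inj₂ (z<y , y<x)) =
  (x ∷ ((λ _ → y<x) , (λ _ → ℤ.<-trans z<y y<x))) , insert , skip
  where
  insert : ∀ {v} → Pinnacle (x ∷ z ∷ _) v → Pinnacle (x ∷ y ∷ z ∷ _) v
  insert (at x<z _) = ⊥-elim (ℤ.<-asym x<z (ℤ.<-trans z<y y<x))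
  insert (later p) = later (later p)
  skip : ∀ {v} → Pinnacle (x ∷ y ∷ z ∷ _) v → Pinnacle (x ∷ z ∷ _) v
  skip (at x<y _) = ⊥-elim (ℤ.<-asym x<y y<x)
  skip (later (at y<z _)) = ⊥-elim (ℤ.<-asym z<y y<z)
  skip (later (later p)) = later p

neg-swap-< : ∀ {a b} → - a <ᶻ b → - b <ᶻ a
neg-swap-< {a} {b} -a<b = ℤ.neg-cancel-< (subst (- a <ᶻ_) (sym (ℤ.neg-involutive b)) -a<b)

flip-below-peak : ∀ {x y z rest} → y <ᶻ x → - y <ᶻ x → z <ᶻ y → ¬ (- y <ᶻ z × Falls (z ∷ rest)) →
                  Interchangeable (x ∷ - y ∷ z ∷ rest) (x ∷ y ∷ z ∷ rest)
flip-below-peak {x} {y} {z} y<x -y<x z<y z-not-peak =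
  (x ∷ ((λ _ → y<x) , (λ _ → -y<x))) , flipped⊆ , original⊆
  where
  flipped⊆ : ∀ {v} → Pinnacle (x ∷ - y ∷ z ∷ _) v → Pinnacle (x ∷ y ∷ z ∷ _) v
  flipped⊆ (at x<-y _) = ⊥-elim (ℤ.<-asym x<-y -y<x)
  flipped⊆ (later (at -y<z c<z)) = ⊥-elim (z-not-peak (-y<z , c<z))
  flipped⊆ (later (later p)) = later (later p)
  original⊆ : ∀ {v} → Pinnacle (x ∷ y ∷ z ∷ _) v → Pinnacle (x ∷ - y ∷ z ∷ _) v
  original⊆ (at x<y _) = ⊥-elim (ℤ.<-asym x<y y<x)
  original⊆ (later (at y<z _)) = ⊥-elim (ℤ.<-asym y<z z<y)
  original⊆ (later (later p)) = later (later p)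

-- Walk down the descent x > y > z > ⋯ while the next entry lies above the negation of the
-- current one; the entry where this stops can be negated harmlessly.
flip-in-descent : ∀ {x y z} rest → y <ᶻ x → - y <ᶻ x → z <ᶻ y →
  ∃[ A ] ∃[ v ] ∃[ C ] (y ∷ z ∷ rest ≡ A ++ v ∷ C ×
                        Interchangeable (x ∷ A ++ - v ∷ C) (x ∷ A ++ v ∷ C))
flip-in-descent [] y<x -y<x z<y = [] , _ , _ , refl , flip-below-peak y<x -y<x z<y (λ ())
flip-in-descent {x} {y} {z} (t ∷ rest) y<x -y<x z<y with t ℤ.<? z | - y ℤ.<? z
... | no t≮z | _ = [] , _ , _ , refl , flip-below-peak y<x -y<x z<y (t≮z ∘ proj₂)
... | yes _ | no -y≮z = [] , _ , _ , refl , flip-below-peak y<x -y<x z<y (-y≮z ∘ proj₁)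
... | yes t<z | yes -y<z with flip-in-descent rest z<y (neg-swap-< -y<z) t<z
... | A , v , C , eq , flip = y ∷ A , v , C , cong (y ∷_) eq , ∷-interchangeable x flip

Flippable : List ℤ → Set
Flippable w = ∃[ A ] ∃[ y ] ∃[ C ] (w ≡ A ++ y ∷ C × Pinnacle (A ++ - y ∷ C) ≐ Pinnacle w)

descent-flippable : ∀ {x y z rest} → y <ᶻ x → - y <ᶻ x → z <ᶻ y → Flippable (x ∷ y ∷ z ∷ rest)
descent-flippable {x} {rest = rest} y<x -y<x z<y with flip-in-descent rest y<x -y<x z<y
... | A , v , C , eq , flip =
  x ∷ A , v , C , cong (x ∷_) eq ,
  subst (λ L → Pinnacle (x ∷ A ++ - v ∷ C) ≐ Pinnacle (x ∷ L)) (sym eq) (proj₂ flip)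

data Alternating : List ℤ → Set where
  valley : ∀ v → Alternating (v ∷ [])
  peak   : ∀ {v p u r} → v <ᶻ p → u <ᶻ p → Alternating (u ∷ r) → Alternating (v ∷ p ∷ u ∷ r)

pinnacles : List ℤ → List ℤ
pinnacles (_ ∷ p ∷ r) = p ∷ pinnacles r
pinnacles _ = []

valleys : List ℤ → List ℤ
valleys (v ∷ _ ∷ r) = v ∷ valleys r
valleys r = r

pinnacles-∷ : ∀ {a b} r → pinnacles (a ∷ r) ≡ pinnacles (b ∷ r)
pinnacles-∷ [] = refl
pinnacles-∷ (_ ∷ _) = refl

valleys-∷ : ∀ a r → valleys (a ∷ r) ≡ a ∷ valleys (drop 1 r)
valleys-∷ a [] = refl
valleys-∷ a (_ ∷ _) = refl

↭-valleys++pinnacles : ∀ w → w ↭ valleys w ++ pinnacles w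
↭-valleys++pinnacles [] = ↭-refl
↭-valleys++pinnacles (v ∷ []) = ↭-refl
↭-valleys++pinnacles (v ∷ p ∷ r) =
  prep v (↭-trans (prep p (↭-valleys++pinnacles r)) (↭-sym (↭-shift p (valleys r) (pinnacles r))))

∈-pinnacles⇒∈ : ∀ {w x} → x ∈ pinnacles w → x ∈ w
∈-pinnacles⇒∈ {w} x∈ = ∈-resp-↭ (↭-sym (↭-valleys++pinnacles w)) (∈-++⁺ʳ (valleys w) x∈)

∈-valleys⇒∈ : ∀ {w x} → x ∈ valleys w → x ∈ w
∈-valleys⇒∈ {w} x∈ = ∈-resp-↭ (↭-sym (↭-valleys++pinnacles w)) (∈-++⁺ˡ x∈)

alternating-pinnacles : ∀ {w} → Alternating w → Pinnacle w ≐ (_∈ pinnacles w)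
alternating-pinnacles (valley v) = (λ { (later ()) }) , (λ ())
alternating-pinnacles (peak {v} {p} {u} {r} v<p u<p alt) = listed , pinnacle
  where
  listed : ∀ {x} → Pinnacle (v ∷ p ∷ u ∷ r) x → x ∈ pinnacles (v ∷ p ∷ u ∷ r)
  listed (at _ _) = here refl
  listed (later (at p<u _)) = ⊥-elim (ℤ.<-asym p<u u<p)
  listed (later (later x∈)) = there (proj₁ (alternating-pinnacles alt) x∈)
  pinnacle : ∀ {x} → x ∈ pinnacles (v ∷ p ∷ u ∷ r) → Pinnacle (v ∷ p ∷ u ∷ r) x
  pinnacle (here refl) = at v<p u<p
  pinnacle (there x∈) = later (later (proj₂ (alternating-pinnacles alt) x∈))

alternating-same-pinnacles : ∀ {w w′} → Alternating w → Alternating w′ → pinnacles w ≡ pinnacles w′ →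
                             Pinnacle w ≐ Pinnacle w′
alternating-same-pinnacles {w} alt alt′ eq =
  ≐-trans (alternating-pinnacles alt)
    (≐-trans (subst (λ ps → (_∈ pinnacles w) ≐ (_∈ ps)) eq ≐-refl) (≐-sym (alternating-pinnacles alt′)))

alternating-length : ∀ {w} → Alternating w → length w ≡ 2 * length (pinnacles w) + 1
alternating-length (valley v) = refl
alternating-length (peak {u = u} {r} _ _ alt) =
  trans (cong (suc ∘ suc) (alternating-length alt)) (cong (_+ 1) (sym (ℕ.*-suc 2 (length (pinnacles (u ∷ r))))))

StartsBelow : List ℤ → ℤ → Set
StartsBelow (a ∷ _) p = a <ᶻ p
StartsBelow [] _ = ⊥

StartsLower : List ℤ → List ℤ → Set
StartsLower (a ∷ _) (b ∷ _) = a ≤ᶻ b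
StartsLower _ _ = ⊥

starts-lower-below : ∀ {L M p} → StartsLower L M → StartsBelow M p → StartsBelow L p
starts-lower-below {_ ∷ _} {_ ∷ _} = ℤ.≤-<-trans

alternating-starts-below : ∀ {w p} → Alternating w → (∀ {x} → x ∈ valleys w → x <ᶻ p) → StartsBelow w p
alternating-starts-below (valley v) below = below (here refl)
alternating-starts-below (peak _ _ _) below = below (here refl)

cons-alternating : ∀ {v p L} → v <ᶻ p → StartsBelow L p → Alternating L → Alternating (v ∷ p ∷ L)
cons-alternating v<p u<p (valley u) = peak v<p u<p (valley u)
cons-alternating v<p u<p alt@(peak _ _ _) = peak v<p u<p alt

lower-valley : ∀ {w x d} → Alternating w → x ∈ valleys w → d ≤ᶻ x →
  ∃[ A ] ∃[ C ] (w ≡ A ++ x ∷ C × Alternating (A ++ d ∷ C) ×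
                 pinnacles (A ++ d ∷ C) ≡ pinnacles w × StartsLower (A ++ d ∷ C) w)
lower-valley (valley v) (here refl) d≤x = [] , [] , refl , valley _ , refl , d≤x
lower-valley (peak v<p u<p alt) (here refl) d≤x =
  [] , _ , refl , peak (ℤ.≤-<-trans d≤x v<p) u<p alt , refl , d≤x
lower-valley (peak {v} {p} v<p u<p alt) (there x∈) d≤x with lower-valley alt x∈ d≤x
... | A , C , eq , alt′ , same , lower =
  v ∷ p ∷ A , C , cong (λ t → v ∷ p ∷ t) eq , cons-alternating v<p (starts-lower-below lower u<p) alt′ ,
  cong (p ∷_) same , ℤ.≤-refl

-- The pinnacle s is removed together with the larger of its two neighbouring valleys, so that
-- what remains still alternates.
extract-pinnacle : ∀ {w s} → Alternating w → s ∈ pinnacles w →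
  ∃[ d ] ∃[ w₁ ] (Alternating w₁ × w ↭ d ∷ s ∷ w₁ × StartsLower w₁ w ×
                  pinnacles w ↭ s ∷ pinnacles w₁ × valleys w ↭ d ∷ valleys w₁)
extract-pinnacle (peak {v} {p} {u} {r} v<p u<p alt) (here refl) with u ℤ.≤? v
... | yes u≤v = v , u ∷ r , alt , ↭-refl , u≤v , ↭-refl , ↭-refl
... | no u≰v = u , v ∷ r , lower-first alt , swap-valleys , ℤ.≤-refl ,
                 ↭-reflexive (cong (p ∷_) (pinnacles-∷ r)) ,
                 subst₂ (λ V U → v ∷ V ↭ u ∷ U) (sym (valleys-∷ u r)) (sym (valleys-∷ v r)) (swap v u ↭-refl)
  where
  v<u : v <ᶻ u
  v<u = ℤ.≰⇒> u≰v
  lower-first : ∀ {r} → Alternating (u ∷ r) → Alternating (v ∷ r)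
  lower-first (valley _) = valley v
  lower-first (peak u<q t<q alt′) = peak (ℤ.<-trans v<u u<q) t<q alt′
  swap-valleys : v ∷ p ∷ u ∷ r ↭ u ∷ p ∷ v ∷ r
  swap-valleys = ↭-trans (swap v p ↭-refl) (↭-trans (prep p (swap v u ↭-refl)) (swap p u ↭-refl))
extract-pinnacle {s = s} (peak {v} {p} v<p u<p alt) (there s∈) with extract-pinnacle alt s∈
... | d , w₁ , alt₁ , w↭ , lower , pins↭ , vals↭ =
  d , v ∷ p ∷ w₁ , cons-alternating v<p (starts-lower-below lower u<p) alt₁ ,
  ↭-trans (prep v (prep p w↭)) (↭-shifts (v ∷ p ∷ []) (d ∷ s ∷ [])) , ℤ.≤-refl ,
  ↭-trans (prep p pins↭) (swap p s ↭-refl) , ↭-trans (prep v vals↭) (swap v d ↭-refl)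

module _ {A : Set} where

  count : {P : Pred A 0ℓ} → Decidable P → List A → ℕ
  count P? xs = length (filter P? xs)

  module _ {P Q : Pred A 0ℓ} (P? : Decidable P) (Q? : Decidable Q) where

    count-∩ : ∀ xs → count P? (filter Q? xs) ≡ count (P? ∩? Q?) xs
    count-∩ [] = refl
    count-∩ (x ∷ xs) with Q? x
    ... | yes _ with P? x
    ...   | yes _ = cong suc (count-∩ xs)
    ...   | no _  = count-∩ xs
    count-∩ (x ∷ xs) | no _ with P? x
    ...   | yes _ = count-∩ xs
    ...   | no _  = count-∩ xs

    count-mono : ∀ xs → (∀ {x} → x ∈ xs → P x → Q x) → count P? xs ≤ count Q? xs
    count-mono [] _ = z≤n
    count-mono (x ∷ xs) P⇒Q with P? x | Q? x | count-mono xs (P⇒Q ∘ there)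
    ... | yes p | no ¬q | _  = ⊥-elim (¬q (P⇒Q (here refl) p))
    ... | yes _ | yes _ | ih = s≤s ih
    ... | no _  | yes _ | ih = ℕ.m≤n⇒m≤1+n ih
    ... | no _  | no _  | ih = ih

    count-mono-< : ∀ xs → (∀ {x} → x ∈ xs → P x → Q x) → ∀ {y} → y ∈ xs → Q y → ¬ P y →
                   count P? xs < count Q? xs
    count-mono-< (x ∷ xs) P⇒Q (here refl) q ¬p with P? x | Q? x
    ... | yes p | _     = ⊥-elim (¬p p)
    ... | no _  | no ¬q = ⊥-elim (¬q q)
    ... | no _  | yes _ = s≤s (count-mono xs (P⇒Q ∘ there))
    count-mono-< (x ∷ xs) P⇒Q (there y∈) q ¬p with P? x | Q? x | count-mono-< xs (P⇒Q ∘ there) y∈ q ¬p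
    ... | yes p | no ¬q | _  = ⊥-elim (¬q (P⇒Q (here refl) p))
    ... | yes _ | yes _ | ih = s≤s ih
    ... | no _  | yes _ | ih = ℕ.m<n⇒m<1+n ih
    ... | no _  | no _  | ih = ih

    count-partition : ∀ xs → (∀ {x} → x ∈ xs → P x ⊎ Q x) → (∀ {x} → P x → ¬ Q x) →
                      count P? xs + count Q? xs ≡ length xs
    count-partition [] _ _ = refl
    count-partition (x ∷ xs) P∪Q disjoint with P? x | Q? x | count-partition xs (P∪Q ∘ there) disjoint
    ... | yes p | yes q | _  = ⊥-elim (disjoint p q)
    ... | yes _ | no _  | ih = cong suc ih
    ... | no _  | yes _ | ih = trans (ℕ.+-suc _ _) (cong suc ih)
    ... | no ¬p | no ¬q | _ with P∪Q (here refl)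
    ...   | inj₁ p = ⊥-elim (¬p p)
    ...   | inj₂ q = ⊥-elim (¬q q)

  module _ {P : Pred A 0ℓ} (P? : Decidable P) where

    count-↭ : ∀ {xs ys} → xs ↭ ys → count P? xs ≡ count P? ys
    count-↭ xs↭ys = ↭-length (filter-↭ P? xs↭ys)

    count-++ : ∀ xs ys → count P? (xs ++ ys) ≡ count P? xs + count P? ys
    count-++ xs ys = trans (cong length (filter-++ P? xs ys)) (length-++ (filter P? xs))

    count-none : ∀ xs → (∀ {x} → x ∈ xs → ¬ P x) → count P? xs ≡ 0
    count-none xs none = cong length (filter-none P? (All.tabulate none))

data OddLength {A : Set} : List A → Set where
  one  : ∀ {x} → OddLength (x ∷ [])
  two+ : ∀ {x y r} → OddLength r → OddLength (x ∷ y ∷ r)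

length-odd : ∀ {A : Set} k {xs : List A} → length xs ≡ 2 * k + 1 → OddLength xs
length-odd k {xs} eq = go k xs (trans eq (ℕ.+-comm (2 * k) 1))
  where
  go : ∀ {A : Set} k (xs : List A) → length xs ≡ suc (2 * k) → OddLength xs
  go zero (_ ∷ []) _ = one
  go (suc k) (_ ∷ _ ∷ xs) eq =
    two+ (go k xs (ℕ.suc-injective (ℕ.suc-injective (trans eq (cong suc (ℕ.*-suc 2 k))))))
  go zero (_ ∷ _ ∷ _) ()
  go (suc k) (_ ∷ []) ()

module _ {A : Set} where

  ++-unique-disjoint : ∀ (xs : List A) {ys x} → Unique (xs ++ ys) → x ∈ xs → x ∈ ys → ⊥
  ++-unique-disjoint (_ ∷ xs) (x∉ AllPairs.∷ _) (here refl) x∈ys = All.lookup x∉ (∈-++⁺ʳ xs x∈ys) refl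
  ++-unique-disjoint (_ ∷ xs) (_ AllPairs.∷ u) (there x∈xs) x∈ys = ++-unique-disjoint xs u x∈xs x∈ys

  unique-adjacent-≢ : ∀ (xs : List A) {x y ys} → Unique (xs ++ x ∷ y ∷ ys) → x ≢ y
  unique-adjacent-≢ [] ((x≢y All.∷ _) AllPairs.∷ _) = x≢y
  unique-adjacent-≢ (_ ∷ xs) (_ AllPairs.∷ u) = unique-adjacent-≢ xs u

  ↭-unique : ∀ {xs ys : List A} → xs ↭ ys → Unique xs → Unique ys
  ↭-unique xs↭ys = PermutationSetoid.Unique-resp-↭ (setoid A) (↭⇒↭ₛ xs↭ys)

  unique-map-injective : ∀ {B : Set} {f : A → B} {xs x y} →
                         Unique (map f xs) → x ∈ xs → y ∈ xs → f x ≡ f y → x ≡ y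
  unique-map-injective _ (here refl) (here refl) _ = refl
  unique-map-injective (fx∉ AllPairs.∷ _) (here refl) (there y∈) fx≡fy =
    ⊥-elim (All.lookup fx∉ (∈-map⁺ _ y∈) fx≡fy)
  unique-map-injective (fy∉ AllPairs.∷ _) (there x∈) (here refl) fx≡fy =
    ⊥-elim (All.lookup fy∉ (∈-map⁺ _ x∈) (sym fx≡fy))
  unique-map-injective (_ AllPairs.∷ u) (there x∈) (there y∈) fx≡fy = unique-map-injective u x∈ y∈ fx≡fy

  swap-ends : ∀ x (xs : List A) y ys → x ∷ xs ++ y ∷ ys ↭ y ∷ xs ++ x ∷ ys
  swap-ends x xs y ys =
    ↭-trans (prep x (↭-shift y xs ys)) (↭-trans (swap x y ↭-refl) (prep y (↭-sym (↭-shift x xs ys))))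

  insert-after : ∀ (xs : List A) x y ys → y ∷ xs ++ x ∷ ys ↭ xs ++ x ∷ y ∷ ys
  insert-after [] x y ys = swap y x ↭-refl
  insert-after (z ∷ xs) x y ys = ↭-trans (swap y z ↭-refl) (prep z (insert-after xs x y ys))

even-or-odd : ∀ m → (2 ∣ m) ⊎ (2 ∣ suc m)
even-or-odd zero = inj₁ (divides 0 refl)
even-or-odd (suc m) with even-or-odd m
... | inj₁ (divides q eq) = inj₂ (divides (suc q) (cong (λ t → suc (suc t)) eq))
... | inj₂ 2∣1+m = inj₁ 2∣1+m

negCount-++ : ∀ xs ys → negCount (xs ++ ys) ≡ negCount xs + negCount ys
negCount-++ [] ys = refl
negCount-++ (+ _ ∷ xs) ys = negCount-++ xs ys
negCount-++ (ℤ.-[1+ _ ] ∷ xs) ys = cong suc (negCount-++ xs ys)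

negCount-flip : ∀ xs m ys → negCount (xs ++ ℤ.-[1+ m ] ∷ ys) ≡ suc (negCount (xs ++ + suc m ∷ ys))
negCount-flip xs m ys = begin
  negCount (xs ++ ℤ.-[1+ m ] ∷ ys)      ≡⟨ negCount-++ xs (ℤ.-[1+ m ] ∷ ys) ⟩
  negCount xs + suc (negCount ys)       ≡⟨ ℕ.+-suc (negCount xs) (negCount ys) ⟩
  suc (negCount xs + negCount ys)       ≡⟨ cong suc (negCount-++ xs (+ suc m ∷ ys)) ⟨
  suc (negCount (xs ++ + suc m ∷ ys))   ∎
  where open ≡-Reasoning

map-abs-flip : ∀ xs y ys → map ∣_∣ (xs ++ - y ∷ ys) ≡ map ∣_∣ (xs ++ y ∷ ys)
map-abs-flip [] y ys = cong (_∷ map ∣_∣ ys) (ℤ.∣-i∣≡∣i∣ y)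
map-abs-flip (x ∷ xs) y ys = cong (∣ x ∣ ∷_) (map-abs-flip xs y ys)

∈[]⇒suc : ∀ {n i} → i ∈ [ n ] → ∃[ m ] i ≡ suc m
∈[]⇒suc i∈ with ∈-map⁻ suc i∈
... | m , _ , i≡1+m = m , i≡1+m

module Witnesses (k : ℕ) (S : List ℤ) (not-D : ¬ APS-D (2 * k + 1) S) where

  n : ℕ
  n = 2 * k + 1

  Witness : List ℤ → Set
  Witness w = SignedPerm n w × (_∈ S) ≐ Pinnacle w

  pinnacleSetOf : ∀ {w} → Witness w → PinnacleSetOf w S
  pinnacleSetOf (_ , S≐) x = mk⇔ (Pinnacle⇒IsPinnacle ∘ proj₁ S≐) (proj₂ S≐ ∘ IsPinnacle⇒Pinnacle)

  witness : ∀ {w} → SignedPerm n w → PinnacleSetOf w S → Witness w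
  witness signed pinnacleSet =
    signed , (IsPinnacle⇒Pinnacle ∘ Equivalence.to (pinnacleSet _)) ,
             (Equivalence.from (pinnacleSet _) ∘ Pinnacle⇒IsPinnacle)

  no-witnesses-of-adjacent-negCount : ∀ {w w′} → Witness w → Witness w′ →
                                      negCount w′ ≡ suc (negCount w) → ⊥
  no-witnesses-of-adjacent-negCount {w} {w′} wit wit′ eq with even-or-odd (negCount w)
  ... | inj₁ even = not-D (w , (proj₁ wit , even) , pinnacleSetOf wit)
  ... | inj₂ odd = not-D (w′ , (proj₁ wit′ , subst (2 ∣_) (sym eq) odd) , pinnacleSetOf wit′)

  witness-resp : ∀ {w w′} → Witness w → map ∣_∣ w′ ↭ map ∣_∣ w → Pinnacle w′ ≐ Pinnacle w →
                 Witness w′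
  witness-resp {w} {w′} ((len , abs↭) , S≐) w′↭w same =
    (trans (sym (length-map ∣_∣ w′)) (trans (↭-length w′↭w) (trans (length-map ∣_∣ w) len)) ,
     ↭-trans w′↭w abs↭) ,
    ≐-trans S≐ (≐-sym same)

  abs∈[n] : ∀ {w x} → Witness w → x ∈ w → ∣ x ∣ ∈ [ n ]
  abs∈[n] ((_ , abs↭) , _) x∈ = ∈-resp-↭ abs↭ (∈-map⁺ ∣_∣ x∈)

  witness-abs-unique : ∀ {w} → Witness w → Unique (map ∣_∣ w)
  witness-abs-unique ((_ , abs↭) , _) = ↭-unique (↭-sym abs↭) (Unique.map⁺ ℕ.suc-injective (Unique.upTo⁺ n))

  witness-unique : ∀ {w} → Witness w → Unique w
  witness-unique = Unique.map⁻ ∘ witness-abs-unique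

  witness-unflippable : ∀ {w} → Witness w → ¬ Flippable w
  witness-unflippable wit (A , + zero , C , refl , _) with ∈[]⇒suc (abs∈[n] wit (∈-++⁺ʳ A (here refl)))
  ... | _ , ()
  witness-unflippable wit (A , + suc m , C , refl , same) =
    no-witnesses-of-adjacent-negCount wit (witness-resp wit (↭-reflexive (map-abs-flip A (+ suc m) C)) same)
      (negCount-flip A m C)
  witness-unflippable wit (A , ℤ.-[1+ m ] , C , refl , same) =
    no-witnesses-of-adjacent-negCount (witness-resp wit (↭-reflexive (map-abs-flip A ℤ.-[1+ m ] C)) same) wit
      (negCount-flip A m C)

  witness-falls : ∀ {a b c rest} → Witness (a ∷ b ∷ c ∷ rest) → c <ᶻ b
  witness-falls {a} {b} {c} wit with c ℤ.<? b
  ... | yes c<b = c<b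
  ... | no c≮b = ⊥-elim (witness-unflippable wit ([] , a , _ , refl , head-irrelevant c≮b))

  witness-rises : ∀ {a b c rest} → Witness (a ∷ b ∷ c ∷ rest) → a <ᶻ b
  witness-rises {a} {b} wit with ℤ.<-cmp a b
  ... | tri< a<b _ _ = a<b
  ... | tri≈ _ a≡b _ = ⊥-elim (unique-adjacent-≢ [] (witness-unique wit) a≡b)
  ... | tri> _ _ b<a with - a ℤ.<? b
  ...   | yes -a<b = ⊥-elim (witness-unflippable wit (descent-flippable b<a (neg-swap-< -a<b) (witness-falls wit)))
  ...   | no -a≮b = ⊥-elim (witness-unflippable wit ([] , a , _ , refl ,
                      head-replace (λ -a<b _ → ⊥-elim (-a≮b -a<b)) (λ a<b _ → ⊥-elim (ℤ.<-asym a<b b<a))))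

  rises-without : ∀ a A {x y z B} → Witness (a ∷ A ++ x ∷ y ∷ z ∷ B) → Rises (a ∷ A ++ x ∷ z ∷ B)
  rises-without a [] wit = witness-rises wit
  rises-without a (_ ∷ []) wit = witness-rises wit
  rises-without a (_ ∷ _ ∷ _) wit = witness-rises wit

  -- Moving y to the front would give a witness whose first entry can be negated freely.
  no-monotone-triple : ∀ a A {x y z} B → Witness (a ∷ A ++ x ∷ y ∷ z ∷ B) → ¬ Monotone x y z
  no-monotone-triple a A {x} {y} {z} B wit mono =
    witness-unflippable moved ([] , y , R , refl , head-irrelevant (rises⇒¬falls R-rises))
    where
    R : List ℤ
    R = a ∷ A ++ x ∷ z ∷ B
    R-rises : Rises R
    R-rises = rises-without a A wit
    moved : Witness (y ∷ R)
    moved = witness-resp wit (map⁺ ∣_∣ (insert-after (a ∷ A) x y (z ∷ B)))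
              (≐-trans (prepend-before-rise R R-rises) (proj₂ (++-interchangeable (a ∷ A) (skip-monotone mono))))

  alternating-after : ∀ a P {b c} r → Witness (a ∷ P ++ b ∷ c ∷ r) → c <ᶻ b → OddLength (c ∷ r) →
                      Alternating (c ∷ r)
  alternating-after a P [] _ _ one = valley _
  alternating-after a P {b} {c} (d ∷ f ∷ r) wit c<b (two+ odd) =
    peak c<d f<d (alternating-after a (P ++ b ∷ c ∷ []) r wit₂ f<d odd)
    where
    wit₁ : Witness (a ∷ (P ++ b ∷ []) ++ c ∷ d ∷ f ∷ r)
    wit₁ = subst (λ L → Witness (a ∷ L)) (sym (++-assoc P (b ∷ []) (c ∷ d ∷ f ∷ r))) wit
    wit₂ : Witness (a ∷ (P ++ b ∷ c ∷ []) ++ d ∷ f ∷ r)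
    wit₂ = subst (λ L → Witness (a ∷ L)) (sym (++-assoc P (b ∷ c ∷ []) (d ∷ f ∷ r))) wit
    c<d : c <ᶻ d
    c<d with ℤ.<-cmp c d
    ... | tri< c<d _ _ = c<d
    ... | tri≈ _ c≡d _ = ⊥-elim (unique-adjacent-≢ (a ∷ P ++ b ∷ []) (witness-unique wit₁) c≡d)
    ... | tri> _ _ d<c = ⊥-elim (no-monotone-triple a P (f ∷ r) wit (inj₂ (d<c , c<b)))
    f<d : f <ᶻ d
    f<d with ℤ.<-cmp d f
    ... | tri< d<f _ _ = ⊥-elim (no-monotone-triple a (P ++ b ∷ []) r wit₁ (inj₁ (c<d , d<f)))
    ... | tri≈ _ d≡f _ = ⊥-elim (unique-adjacent-≢ (a ∷ P ++ b ∷ c ∷ []) (witness-unique wit₂) d≡f)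
    ... | tri> _ _ f<d = f<d

  witness-alternating : ∀ {w} → Witness w → Alternating w
  witness-alternating wit = from-odd (length-odd k (proj₁ (proj₁ wit))) wit
    where
    from-odd : ∀ {w} → OddLength w → Witness w → Alternating w
    from-odd one _ = valley _
    from-odd (two+ {r = []} ())
    from-odd (two+ {r = c ∷ r} odd) wit =
      peak (witness-rises wit) (witness-falls wit) (alternating-after _ [] r wit (witness-falls wit) odd)

  module _ {w} (wit : Witness w) where

    private
      alt : Alternating w
      alt = witness-alternating wit

    valleys-negative : ∀ {x} → x ∈ valleys w → x <ᶻ 0ℤ
    valleys-negative {+ zero} x∈ with ∈[]⇒suc (abs∈[n] wit (∈-valleys⇒∈ x∈))
    ... | _ , ()
    valleys-negative {ℤ.-[1+ _ ]} _ = ℤ.-<+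
    valleys-negative {+ suc m} x∈ with lower-valley alt x∈ ℤ.-≤+
    ... | A , C , eq , alt′ , same , _ =
      ⊥-elim (witness-unflippable wit (A , + suc m , C , eq , alternating-same-pinnacles alt′ alt same))

    rearranged-witness : ∀ {w′} → Alternating w′ → w′ ↭ w → pinnacles w′ ↭ pinnacles w → Witness w′
    rearranged-witness alt′ w′↭w pins↭ = witness-resp wit (map⁺ ∣_∣ w′↭w)
      (≐-trans (alternating-pinnacles alt′)
        (≐-trans (∈-resp-↭ pins↭ , ∈-resp-↭ (↭-sym pins↭)) (≐-sym (alternating-pinnacles alt))))

    front-flip : ∀ {x s Z} → Alternating Z → StartsBelow Z s → x <ᶻ s → - x <ᶻ s →
                 x ∷ s ∷ Z ↭ w → s ∷ pinnacles Z ↭ pinnacles w → ⊥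
    front-flip altZ below x<s -x<s perm pins↭ =
      witness-unflippable (rearranged-witness (cons-alternating x<s below altZ) perm pins↭)
        ([] , _ , _ , refl ,
         alternating-same-pinnacles (cons-alternating -x<s below altZ) (cons-alternating x<s below altZ) refl)

    -- Bring s to the front next to a valley that is smaller than s in absolute value; that
    -- valley could then be negated.
    no-small-valley : ∀ {s v} → s ∈ pinnacles w → 0ℤ <ᶻ s → v ∈ valleys w → - v <ᶻ s → ⊥
    no-small-valley {s} {v} s∈ 0<s v∈ -v<s with extract-pinnacle alt s∈
    ... | d , w₁ , alt₁ , w↭ , lower , pins↭ , vals↭ = flip-smaller (v ℤ.≤? d)
      where
      below-s : ∀ {x} → x ∈ valleys w → x <ᶻ s
      below-s x∈ = ℤ.<-trans (valleys-negative x∈) 0<s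
      below₁ : StartsBelow w₁ s
      below₁ = starts-lower-below lower (alternating-starts-below alt below-s)
      flip-smaller : Dec (v ≤ᶻ d) → ⊥
      flip-smaller (yes v≤d) =
        front-flip alt₁ below₁ (below-s (∈-resp-↭ (↭-sym vals↭) (here refl)))
          (ℤ.≤-<-trans (ℤ.neg-mono-≤ v≤d) -v<s)
          (↭-sym w↭) (↭-sym pins↭)
      flip-smaller (no v≰d) with ∈-resp-↭ vals↭ v∈
      ... | here v≡d = v≰d (ℤ.≤-reflexive v≡d)
      ... | there v∈₁ with lower-valley alt₁ v∈₁ (ℤ.<⇒≤ (ℤ.≰⇒> v≰d))
      ... | A , C , eq , alt₂ , same , lower₂ =
        front-flip alt₂ (starts-lower-below lower₂ below₁) (below-s v∈) -v<s
          (↭-sym (↭-trans w↭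
            (subst (λ L → d ∷ s ∷ L ↭ v ∷ s ∷ A ++ d ∷ C) (sym eq) (swap-ends d (s ∷ A) v C))))
          (↭-sym (subst (λ P → pinnacles w ↭ s ∷ P) (sym same) pins↭))

    positive-pinnacle<∣valley∣ : ∀ {s v} → s ∈ pinnacles w → 0ℤ <ᶻ s → v ∈ valleys w → s <ᶻ - v
    positive-pinnacle<∣valley∣ {s} {v} s∈ 0<s v∈ with ℤ.<-cmp s (- v)
    ... | tri< s<-v _ _ = s<-v
    ... | tri≈ _ s≡-v _ = ⊥-elim (ℤ.<-asym (valleys-negative v∈) (subst (0ℤ <ᶻ_) s≡v 0<s))
      where
      s≡v : s ≡ v
      s≡v = unique-map-injective (witness-abs-unique wit) (∈-pinnacles⇒∈ s∈) (∈-valleys⇒∈ v∈)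
              (trans (cong ∣_∣ s≡-v) (ℤ.∣-i∣≡∣i∣ v))
    ... | tri> _ _ -v<s = ⊥-elim (no-small-valley s∈ 0<s v∈ -v<s)

    private
      S⇒pinnacle : ∀ {x} → x ∈ S → x ∈ pinnacles w
      S⇒pinnacle = proj₁ (alternating-pinnacles alt) ∘ proj₁ (proj₂ wit)

      pinnacle⇒S : ∀ {x} → x ∈ pinnacles w → x ∈ S
      pinnacle⇒S = proj₂ (proj₂ wit) ∘ proj₂ (alternating-pinnacles alt)

    Positive Negative Valley : Pred ℕ 0ℓ
    Positive i = + i ∈ S
    Negative i = - (+ i) ∈ S
    Valley i = - (+ i) ∈ valleys w

    Positive? : Decidable Positive
    Positive? i = + i ∈? S

    Negative? : Decidable Negative
    Negative? i = - (+ i) ∈? S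

    positive∈[n] : ∀ {i} → Positive i → i ∈ [ n ]
    positive∈[n] = abs∈[n] wit ∘ ∈-pinnacles⇒∈ ∘ S⇒pinnacle

    positive⇒¬negative : ∀ {i} → Positive i → ¬ Negative i
    positive⇒¬negative {i} pos neg with ∈[]⇒suc (positive∈[n] pos)
    ... | m , refl with unique-map-injective (witness-abs-unique wit)
                          (∈-pinnacles⇒∈ (S⇒pinnacle pos)) (∈-pinnacles⇒∈ (S⇒pinnacle neg)) refl
    ... | ()

    positive<valley : ∀ {i j} → Positive i → Valley j → i < j
    positive<valley {i} {j} pos val with ∈[]⇒suc (positive∈[n] pos)
    ... | m , refl = ℤ.drop‿+<+ (subst (+ i <ᶻ_) (ℤ.neg-involutive (+ j))
                       (positive-pinnacle<∣valley∣ (S⇒pinnacle pos) (ℤ.+<+ (s≤s z≤n)) val))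

    valley-abs : ∀ {x} → x ∈ valleys w → Valley ∣ x ∣
    valley-abs {+ _} x∈v = ⊥-elim (ℤ.+≮0 (valleys-negative x∈v))
    valley-abs {ℤ.-[1+ _ ]} x∈v = x∈v

    pinnacle-abs : ∀ {x} → x ∈ pinnacles w → Positive ∣ x ∣ ⊎ Negative ∣ x ∣
    pinnacle-abs {+ _} x∈p = inj₁ (pinnacle⇒S x∈p)
    pinnacle-abs {ℤ.-[1+ _ ]} x∈p = inj₂ (pinnacle⇒S x∈p)

    classify : ∀ {i} → i ∈ [ n ] → Positive i ⊎ Negative i ⊎ Valley i
    classify i∈ with ∈-map⁻ ∣_∣ (∈-resp-↭ (↭-sym (proj₂ (proj₁ wit))) i∈)
    ... | x , x∈ , refl with ∈-++⁻ (valleys w) (∈-resp-↭ (↭-valleys++pinnacles w) x∈)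
    ... | inj₁ x∈v = inj₂ (inj₂ (valley-abs x∈v))
    ... | inj₂ x∈p = map₂ inj₁ (pinnacle-abs x∈p)

    valley⇒¬negative : ∀ {i} → Valley i → ¬ Negative i
    valley⇒¬negative val neg = ++-unique-disjoint (valleys w)
      (↭-unique (↭-valleys++pinnacles w) (witness-unique wit)) val (S⇒pinnacle neg)

    pinnacle-count : length (pinnacles w) ≡ k
    pinnacle-count = ℕ.*-cancelˡ-≡ _ _ 2
      (ℕ.+-cancelʳ-≡ 1 _ _ (trans (sym (alternating-length alt)) (proj₁ (proj₁ wit))))

    count-on-pinnacles : ∀ {Q : Pred ℕ 0ℓ} (Q? : Decidable Q) → (∀ {i} → Valley i → ¬ Q i) →
                         count Q? [ n ] ≡ count Q? (map ∣_∣ (pinnacles w))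
    count-on-pinnacles {Q} Q? ¬Q = begin
      count Q? [ n ]
        ≡⟨ count-↭ Q? [n]↭ ⟩
      count Q? (map ∣_∣ (valleys w) ++ map ∣_∣ (pinnacles w))
        ≡⟨ count-++ Q? (map ∣_∣ (valleys w)) _ ⟩
      count Q? (map ∣_∣ (valleys w)) + count Q? (map ∣_∣ (pinnacles w))
        ≡⟨ cong (_+ count Q? (map ∣_∣ (pinnacles w))) (count-none Q? _ none) ⟩
      count Q? (map ∣_∣ (pinnacles w)) ∎
      where
      open ≡-Reasoning
      [n]↭ : [ n ] ↭ map ∣_∣ (valleys w) ++ map ∣_∣ (pinnacles w)
      [n]↭ = ↭-trans (↭-sym (proj₂ (proj₁ wit)))
               (↭-trans (map⁺ ∣_∣ (↭-valleys++pinnacles w))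
                        (↭-reflexive (map-++ ∣_∣ (valleys w) (pinnacles w))))
      none : ∀ {i} → i ∈ map ∣_∣ (valleys w) → ¬ Q i
      none i∈ with ∈-map⁻ ∣_∣ i∈
      ... | _ , x∈v , refl = ¬Q (valley-abs x∈v)

    positives+negatives≡k : count Positive? [ n ] + count Negative? [ n ] ≡ k
    positives+negatives≡k = begin
      count Positive? [ n ] + count Negative? [ n ]
        ≡⟨ cong₂ _+_ (count-on-pinnacles Positive? (λ val pos → ℕ.<-irrefl refl (positive<valley pos val)))
                     (count-on-pinnacles Negative? valley⇒¬negative) ⟩
      count Positive? (map ∣_∣ (pinnacles w)) + count Negative? (map ∣_∣ (pinnacles w))
        ≡⟨ count-partition Positive? Negative? _ pinnacle-abs′ positive⇒¬negative ⟩
      length (map ∣_∣ (pinnacles w))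
        ≡⟨ length-map ∣_∣ (pinnacles w) ⟩
      length (pinnacles w)
        ≡⟨ pinnacle-count ⟩
      k ∎
      where
      open ≡-Reasoning
      pinnacle-abs′ : ∀ {i} → i ∈ map ∣_∣ (pinnacles w) → Positive i ⊎ Negative i
      pinnacle-abs′ i∈ with ∈-map⁻ ∣_∣ i∈
      ... | _ , x∈p , refl = pinnacle-abs x∈p

    k∸negatives≡positives : k ∸ count Negative? [ n ] ≡ count Positive? [ n ]
    k∸negatives≡positives =
      trans (cong (_∸ count Negative? [ n ]) (sym positives+negatives≡k))
            (ℕ.m+n∸n≡m (count Positive? [ n ]) (count Negative? [ n ]))

    rank<positives : ∀ {j} → Positive j → rankInComplement n S j < count Positive? [ n ]
    rank<positives {j} pos =
      subst (_< count Positive? [ n ]) (sym (count-∩ (¬? ∘ Negative?) (_<? j) [ n ]))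
        (count-mono-< _ Positive? [ n ] smaller-positive (positive∈[n] pos) pos (ℕ.<-irrefl refl ∘ proj₂))
      where
      smaller-positive : ∀ {i} → i ∈ [ n ] → ¬ Negative i × i < j → Positive i
      smaller-positive i∈ (¬neg , i<j) with classify i∈
      ... | inj₁ pos′ = pos′
      ... | inj₂ (inj₁ neg) = ⊥-elim (¬neg neg)
      ... | inj₂ (inj₂ val) = ⊥-elim (ℕ.<-asym i<j (positive<valley pos val))

    positives≤rank : ∀ {j} → Valley j → count Positive? [ n ] ≤ rankInComplement n S j
    positives≤rank {j} val =
      subst (count Positive? [ n ] ≤_) (sym (count-∩ (¬? ∘ Negative?) (_<? j) [ n ]))
        (count-mono Positive? _ [ n ] (λ _ pos → positive⇒¬negative pos , positive<valley pos val))

lemma4p5 : (k : ℕ) (S : List ℤ) →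
    APS-B (2 * k + 1) S → ¬ APS-D (2 * k + 1) S →
    -- P = S ∩ ℕ is exactly the (k - |N|) smallest elements of [2k+1] ∖ -N
    ((j : ℕ) → ((+ j ∈ S) × (0 < j)) ⇔
       (InComplement (2 * k + 1) S j ×
        rankInComplement (2 * k + 1) S j < k ∸ negPartSize (2 * k + 1) S))
lemma4p5 k S (w , signed , pinnacleSet) not-D j = mk⇔ forward backward
  where
  open Witnesses k S not-D
  wit : Witness w
  wit = witness signed pinnacleSet
  forward : + j ∈ S × 0 < j → InComplement n S j × rankInComplement n S j < k ∸ negPartSize n S
  forward (pos , _) = (positive∈[n] wit pos , positive⇒¬negative wit pos) ,
    subst (rankInComplement n S j <_) (sym (k∸negatives≡positives wit)) (rank<positives wit pos)
  backward : InComplement n S j × rankInComplement n S j < k ∸ negPartSize n S → + j ∈ S × 0 < j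
  backward ((j∈ , ¬neg) , rank<) with classify wit j∈ | ∈[]⇒suc j∈
  ... | inj₁ pos | _ , refl = pos , s≤s z≤n
  ... | inj₂ (inj₁ neg) | _ = ⊥-elim (¬neg neg)
  ... | inj₂ (inj₂ val) | _ =
    ⊥-elim (ℕ.<⇒≱ rank<
      (subst (_≤ rankInComplement n S j) (sym (k∸negatives≡positives wit)) (positives≤rank wit val)))
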